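{- Let $\mathbf u$ be a simple Parry sequence with parameters $m\ge 2$, $t_1,\dots,t_m$. For $n\in\mathbb N$, $n\ge m$, let $z_n=u_nu_{n-m}^{t_1-t_m}u_{n-m-1}^{t_2}\cdots u_{n-2m+1}^{t_m}$ and $s_n=u_nu_{n-m}^{t_1-t_m+1}u_{n-m-1}^{t_2}\cdots u_{n-2m+1}^{t_m}$ (i.e., $u_n$ followed by $u_{n-m}^{t_1-t_m}$ (resp. $u_{n-m}^{t_1-t_m+1}$) and then $u_{n-m-i}^{t_{i+1}}$ for $i=1,\dots,m-1$), and $Z_n=|z_n|$, $S_n=|s_n|$. Then: (i) both $z_n$ and $s_n$ are prefixes of $\mathbf u$; (ii) $Z_n=U_n+U_{n-m+1}-t_mU_{n-m}$ for $n\ge 2m-1$; (iii) $S_n=Z_n+U_{n-m}$; (iv) $U_n\le Z_n<S_n\le U_{n+1}$; (v) if $t_m>1$, then $Z_n\le P_n$.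
   Context: Simple Parry sequence: $m\in\mathbb N$, $m\ge2$, $t_1,\dots,t_m\in\mathbb N$ with $t_1\ge1$, $t_m\ge1$ and $t_it_{i+1}\cdots t_m0^{\omega}\prec_{\mathrm{lex}}t_1t_2\cdots t_m0^{\omega}$ for each $i\in\{2,\dots,m\}$ (lexicographic order on integer sequences). $\varphi$ is the morphism on $\{0,\dots,m-1\}^*$ with $\varphi(j)=0^{t_{j+1}}(j+1)$ for $0\le j\le m-2$, $\varphi(m-1)=0^{t_m}$, and $\mathbf u$ is its fixed point starting with $0$. Let $u_n=\varphi^n(0)$, $U_n=|u_n|$ for $n\ge0$, and $u_n=\varepsilon$, $U_n=0$ for $n<0$. $P_n=U_n+U_{n-m+1}-U_{n-m}-1$ for $n\ge m$. Note $t_1\ge t_m$ follows from the lexicographic conditions. -}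

module Defs where

open import Data.Nat as ℕ using (ℕ; zero; suc; _<_; _≤_; _<ᵇ_)
open import Data.Integer as ℤ using (ℤ; +_; -[1+_])
open import Data.List using (List; []; _∷_; _++_; concat; concatMap; map; replicate; length; upTo; lookup)
open import Data.Fin using (Fin; toℕ)
open import Data.Bool using (if_then_else_)
open import Data.Product using (Σ; _×_)
open import Relation.Binary.PropositionalEquality using (_≡_)

-- Parameters: m : ℕ and t : ℕ → ℕ, where only t 1, …, t m are meaningful
-- (t i is the paper's t_i; values outside 1..m are never used).

-- The sequence t_i t_{i+1} ⋯ t_m 0^ω, as a function of the position k (0-based).
tailSeq : (m : ℕ) (t : ℕ → ℕ) (i : ℕ) → ℕ → ℕ
tailSeq m t i k = if m <ᵇ i ℕ.+ k then 0 else t (i ℕ.+ k)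

_≺lex_ : (ℕ → ℕ) → (ℕ → ℕ) → Set
a ≺lex b = Σ ℕ λ k → ((j : ℕ) → j < k → a j ≡ b j) × (a k < b k)

record SimpleParry (m : ℕ) (t : ℕ → ℕ) : Set where
  field
    m≥2   : 2 ≤ m
    t₁≥1  : 1 ≤ t 1
    tₘ≥1  : 1 ≤ t m
    lexC  : (i : ℕ) → 2 ≤ i → i ≤ m → tailSeq m t i ≺lex tailSeq m t 1

-- The morphism φ on letters (letters are natural numbers; only 0..m-1 occur).
φ-letter : (m : ℕ) (t : ℕ → ℕ) → ℕ → List ℕ
φ-letter m t j = if suc j <ᵇ m then replicate (t (suc j)) 0 ++ (suc j ∷ [])
                 else replicate (t m) 0

φ : (m : ℕ) (t : ℕ → ℕ) → List ℕ → List ℕ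
φ m t = concatMap (φ-letter m t)

φ^ : (m : ℕ) (t : ℕ → ℕ) → ℕ → List ℕ → List ℕ
φ^ m t zero w = w
φ^ m t (suc k) w = φ m t (φ^ m t k w)

uw : (m : ℕ) (t : ℕ → ℕ) → ℤ → List ℕ
uw m t (+ n) = φ^ m t n (0 ∷ [])
uw m t -[1+ n ] = []

U : (m : ℕ) (t : ℕ → ℕ) → ℤ → ℕ
U m t n = length (uw m t n)

-- The fixed point 𝐮 of φ starting with 0, as an infinite word ℕ → letters:
-- its i-th letter (0-based) is the i-th letter of φ^(i+1)(0) (which has length > i);
-- the default 0 is never used.
nth : List ℕ → ℕ → ℕ
nth [] _ = 0
nth (x ∷ xs) zero = x
nth (x ∷ xs) (suc i) = nth xs i

𝐮 : (m : ℕ) (t : ℕ → ℕ) → ℕ → ℕ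
𝐮 m t i = nth (φ^ m t (suc i) (0 ∷ [])) i

IsPrefixOf𝐮 : (m : ℕ) (t : ℕ → ℕ) → List ℕ → Set
IsPrefixOf𝐮 m t w = (i : Fin (length w)) → lookup w i ≡ 𝐮 m t (toℕ i)

pow : List ℕ → ℕ → List ℕ
pow w k = concat (replicate k w)

-- u_{n-m-1}^{t_2} ⋯ u_{n-2m+1}^{t_m}  (index i' = i+1 ranges over 1..m-1)
tailPart : (m : ℕ) (t : ℕ → ℕ) (n : ℕ) → List ℕ
tailPart m t n =
  concat (map (λ i → pow (uw m t (+ n ℤ.- + m ℤ.- + suc i)) (t (suc (suc i))))
              (upTo (m ℕ.∸ 1)))

z : (m : ℕ) (t : ℕ → ℕ) (n : ℕ) → List ℕ
z m t n = uw m t (+ n) ++ pow (uw m t (+ n ℤ.- + m)) (t 1 ℕ.∸ t m) ++ tailPart m t n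

s : (m : ℕ) (t : ℕ → ℕ) (n : ℕ) → List ℕ
s m t n = uw m t (+ n) ++ pow (uw m t (+ n ℤ.- + m)) (suc (t 1 ℕ.∸ t m)) ++ tailPart m t n

Z : (m : ℕ) (t : ℕ → ℕ) (n : ℕ) → ℕ
Z m t n = length (z m t n)

S : (m : ℕ) (t : ℕ → ℕ) (n : ℕ) → ℕ
S m t n = length (s m t n)

P : (m : ℕ) (t : ℕ → ℕ) (n : ℕ) → ℤ
P m t n = + U m t (+ n) ℤ.+ + U m t (+ n ℤ.- + m ℤ.+ + 1)
          ℤ.- + U m t (+ n ℤ.- + m) ℤ.- + 1

-- Set t_c = 0 for c > m and W_c(k) = u_{k-1}^{t_c} u_{k-2}^{t_{c+1}} ⋯ u_0^{t_{c+k-1}} (tailWord c k).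
-- By induction on k, φ^k(j) = W_{j+1}(k) followed by the letter j+k, which is present only while j+k < m;
-- so u_k = W_1(k)·(k) and, for n = m + d, z_n = u_n u_d^{t_1-t_m} W_2(d).
-- Comparing exponents position by position, the lexicographic conditions make every W_c(k) with c ≥ 2
-- a prefix of W_1(k), hence of u_k. Therefore u_d^{t_1-t_m+1} W_2(d) is a prefix of u_{d+1} = u_d^{t_1} W_2(d)·(d+1),
-- and u_{d+1} is a prefix of W_2(n) because t_m ≥ 1; thus s_n is a prefix of u_n·u_n^{t_1-1} W_2(n)·(n+1) = u_{n+1}.
-- The length statements follow from |u_{d+1}| = t_1 |u_d| + |W_2(d)| + [d+1 < m].

module Submission where

open import Defs
open import Data.Nat using (ℕ; suc; _≤_; _<_; _+_; _*_)
open import Data.Integer as ℤ using (ℤ; +_)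
open import Data.Product using (_×_)
open import Relation.Binary.PropositionalEquality using (_≡_)

open import Algebra.Bundles using (AbelianGroup)
open import Data.Bool using (true; false; if_then_else_)
open import Data.Fin using (toℕ)
open import Data.Fin.Properties using (toℕ<n)
import Data.Integer.Properties as ℤₚ
open import Data.List using (List; []; _∷_; _++_; concat; replicate; length; applyUpTo; lookup)
open import Data.List.Relation.Binary.Prefix.Heterogeneous.Properties using (length-mono)
open import Data.List.Relation.Binary.Prefix.Propositional.Properties using (∣ˡ-as-Prefix)
open import Data.List.Properties using (++-assoc; ++-identityʳ; length-++; length-replicate; concatMap-++; map-upTo; ++-monoid)
open import Data.Nat using (zero; _∸_; _<ᵇ_; _≤‴_; ≤‴-refl; ≤‴-step; z≤n; s≤s; z<s)
open import Data.Nat.Properties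
open import Data.Nat.Tactic.RingSolver using (solve-∀)
open import Data.Product using (_,_)
open import Data.Sum using (inj₁; inj₂)
open import Function using (_∘_)
open import Relation.Binary.PropositionalEquality using (refl; sym; trans; cong; cong₂; subst; subst₂; module ≡-Reasoning)
open import Relation.Binary.Definitions using (tri<; tri≈; tri>)
open import Relation.Nullary using (yes; no)

open import Algebra.Properties.Monoid.Divisibility (++-monoid ℕ)
open import Algebra.Properties.Group (AbelianGroup.group ℤₚ.+-0-abelianGroup) using (//-rightDividesʳ)

[i+j]-j≡i : ∀ i j → i ℤ.+ j ℤ.- j ≡ i
[i+j]-j≡i i j = //-rightDividesʳ j i

i+j≡k⇒i≡k-j : ∀ {i} j {k} → i ℤ.+ j ≡ k → i ≡ k ℤ.- j
i+j≡k⇒i≡k-j {i} j eq = trans (sym ([i+j]-j≡i i j)) (cong (ℤ._- j) eq)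

i+j≤k⇒i≤k-j : ∀ {i} j {k} → i ℤ.+ j ℤ.≤ k → i ℤ.≤ k ℤ.- j
i+j≤k⇒i≤k-j {i} j le = subst (ℤ._≤ _) ([i+j]-j≡i i j) (ℤₚ.+-monoˡ-≤ (ℤ.- j) le)

+[m+n]-m≡n : ∀ m n → + (m + n) ℤ.- + m ≡ + n
+[m+n]-m≡n m n = sym (i+j≡k⇒i≡k-j (+ m) (cong +_ (+-comm n m)))

1+n≤m*n : ∀ {m n} → 2 ≤ m → 1 ≤ n → suc n ≤ m * n
1+n≤m*n {m} {n} 2≤m 1≤n = begin
  1 + n      ≤⟨ +-monoˡ-≤ n 1≤n ⟩
  n + n      ≡⟨ cong (λ k → n + k) (sym (+-identityʳ n)) ⟩
  2 * n      ≤⟨ *-monoˡ-≤ n 2≤m ⟩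
  m * n      ∎
  where open ≤-Reasoning

<⇒<ᵇ≡true : ∀ {a b} → a < b → (a <ᵇ b) ≡ true
<⇒<ᵇ≡true {zero}  {suc b} _         = refl
<⇒<ᵇ≡true {suc a} {suc b} (s≤s a<b) = <⇒<ᵇ≡true a<b

≤⇒<ᵇ≡false : ∀ {a b} → b ≤ a → (a <ᵇ b) ≡ false
≤⇒<ᵇ≡false {b = zero}          _         = refl
≤⇒<ᵇ≡false {suc a} {suc b} (s≤s b≤a) = ≤⇒<ᵇ≡false b≤a

-- Over the free monoid (List ℕ, _++_, []), left divisibility x ∣ˡ y says that x is a prefix of y.

∣ˡ⇒length-≤ : ∀ {x y : List ℕ} → x ∣ˡ y → length x ≤ length y
∣ˡ⇒length-≤ = length-mono ∘ ∣ˡ-as-Prefix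

∣ˡ⇒nth-≡ : ∀ {x y : List ℕ} → x ∣ˡ y → ∀ {i} → i < length x → nth x i ≡ nth y i
∣ˡ⇒nth-≡ {a ∷ x} (q , refl) {zero}  _         = refl
∣ˡ⇒nth-≡ {a ∷ x} (q , refl) {suc i} (s≤s i<x) = ∣ˡ⇒nth-≡ {x} (q , refl) i<x

lookup≡nth : ∀ w i → lookup w i ≡ nth w (toℕ i)
lookup≡nth (a ∷ w) Data.Fin.zero    = refl
lookup≡nth (a ∷ w) (Data.Fin.suc i) = lookup≡nth w i

pow-[] : ∀ a → pow [] a ≡ []
pow-[] zero    = refl
pow-[] (suc a) = pow-[] a

length-pow : ∀ w a → length (pow w a) ≡ a * length w
length-pow w zero    = refl
length-pow w (suc a) = trans (length-++ w) (cong (λ k → length w + k) (length-pow w a))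

length-++-pow-suc : ∀ x w a y → length (x ++ pow w (suc a) ++ y) ≡ length (x ++ pow w a ++ y) + length w
length-++-pow-suc x w a y
  rewrite length-++ x {(w ++ pow w a) ++ y} | length-++ (w ++ pow w a) {y} | length-++ w {pow w a}
        | length-++ x {pow w a ++ y} | length-++ (pow w a) {y}
  = shuffle (length x) (length w) (length (pow w a)) (length y)
  where
    shuffle : ∀ X W P Y → X + ((W + P) + Y) ≡ X + (P + Y) + W
    shuffle = solve-∀

pow-++-∣ˡ-< : ∀ {x w a b} y → a < b → x ∣ˡ w → (pow w a ++ x) ∣ˡ (pow w b ++ y)
pow-++-∣ˡ-< {w = w} {zero} {suc b} y _ x∣w = ∣ˡ-trans x∣w (x∣ˡy⇒x∣ˡyz y (x∣ˡxy w (pow w b)))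
pow-++-∣ˡ-< {x} {w} {suc a} {suc b} y (s≤s a<b) x∣w =
  ∣ˡ-respʳ-≈ (sym (++-assoc w (pow w b) y))
    (∣ˡ-respˡ-≈ (sym (++-assoc w (pow w a) x)) (x∣ˡy⇒zx∣ˡzy w (pow-++-∣ˡ-< y a<b x∣w)))

pow-++-∣ˡ-≤ : ∀ {x w a b} → a ≤ b → x ∣ˡ w → (pow w a ++ x) ∣ˡ (pow w b ++ x)
pow-++-∣ˡ-≤ a≤b x∣w with m≤n⇒m<n∨m≡n a≤b
... | inj₁ a<b  = pow-++-∣ˡ-< _ a<b x∣w
... | inj₂ refl = ∣ˡ-refl

module Substitution (m : ℕ) (t : ℕ → ℕ) where

  u : ℕ → List ℕ
  u k = φ^ m t k (0 ∷ [])

  φ^-suc : ∀ k w → φ^ m t (suc k) w ≡ φ^ m t k (φ m t w)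
  φ^-suc zero    w = refl
  φ^-suc (suc k) w = cong (φ m t) (φ^-suc k w)

  φ^-++ : ∀ k xs ys → φ^ m t k (xs ++ ys) ≡ φ^ m t k xs ++ φ^ m t k ys
  φ^-++ zero    xs ys = refl
  φ^-++ (suc k) xs ys = trans (cong (φ m t) (φ^-++ k xs ys)) (concatMap-++ (φ-letter m t) (φ^ m t k xs) (φ^ m t k ys))

  φ^-[] : ∀ k → φ^ m t k [] ≡ []
  φ^-[] zero    = refl
  φ^-[] (suc k) = cong (φ m t) (φ^-[] k)

  φ^-replicate-0 : ∀ k a → φ^ m t k (replicate a 0) ≡ pow (u k) a
  φ^-replicate-0 k zero    = φ^-[] k
  φ^-replicate-0 k (suc a) = trans (φ^-++ k (0 ∷ []) (replicate a 0)) (cong (u k ++_) (φ^-replicate-0 k a))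

  tailSeq-head : ∀ {c} → c ≤ m → tailSeq m t c 0 ≡ t c
  tailSeq-head {c} c≤m rewrite +-identityʳ c | ≤⇒<ᵇ≡false c≤m = refl

  tailSeq-head-vanishes : ∀ {c} → m < c → tailSeq m t c 0 ≡ 0
  tailSeq-head-vanishes {c} m<c rewrite +-identityʳ c | <⇒<ᵇ≡true m<c = refl

  tailSeq-suc : ∀ i q → tailSeq m t (suc i) q ≡ tailSeq m t i (suc q)
  tailSeq-suc i q rewrite +-suc i q = refl

  tailWord : ℕ → ℕ → List ℕ
  tailWord c zero    = []
  tailWord c (suc k) = pow (u k) (tailSeq m t c 0) ++ tailWord (suc c) k

  tailWord-vanishes : ∀ {c} k → m < c → tailWord c k ≡ []
  tailWord-vanishes zero    _   = refl
  tailWord-vanishes (suc k) m<c rewrite tailSeq-head-vanishes m<c = tailWord-vanishes k (m<n⇒m<1+n m<c)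

  endLetter : ℕ → List ℕ
  endLetter c = if c <ᵇ m then c ∷ [] else []

  endLetter-vanishes : ∀ {c} → m ≤ c → endLetter c ≡ []
  endLetter-vanishes m≤c rewrite ≤⇒<ᵇ≡false m≤c = refl

  φ-endLetter : ∀ c → φ m t (endLetter c) ≡ replicate (tailSeq m t (suc c) 0) 0 ++ endLetter (suc c)
  φ-endLetter c with <-cmp (suc c) m
  ... | tri< 1+c<m _ _
    rewrite <⇒<ᵇ≡true (<-trans (n<1+n c) 1+c<m) | <⇒<ᵇ≡true 1+c<m | tailSeq-head (<⇒≤ 1+c<m)
    = ++-identityʳ _
  ... | tri≈ _ 1+c≡m _
    rewrite <⇒<ᵇ≡true (≤-reflexive 1+c≡m) | ≤⇒<ᵇ≡false (≤-reflexive (sym 1+c≡m)) | tailSeq-head (≤-reflexive 1+c≡m)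
    = cong (λ i → replicate (t i) 0 ++ []) (sym 1+c≡m)
  ... | tri> _ _ m<1+c
    rewrite ≤⇒<ᵇ≡false (≤-pred m<1+c) | ≤⇒<ᵇ≡false (<⇒≤ m<1+c) | tailSeq-head-vanishes m<1+c
    = refl

  φ^-endLetter : ∀ k c → φ^ m t k (endLetter c) ≡ tailWord (suc c) k ++ endLetter (c + k)
  φ^-endLetter zero    c = cong endLetter (sym (+-identityʳ c))
  φ^-endLetter (suc k) c = begin
    φ^ m t (suc k) (endLetter c)                              ≡⟨ φ^-suc k _ ⟩
    φ^ m t k (φ m t (endLetter c))                            ≡⟨ cong (φ^ m t k) (φ-endLetter c) ⟩
    φ^ m t k (replicate τ 0 ++ endLetter (suc c))             ≡⟨ φ^-++ k _ _ ⟩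
    φ^ m t k (replicate τ 0) ++ φ^ m t k (endLetter (suc c))  ≡⟨ cong₂ _++_ (φ^-replicate-0 k τ) (φ^-endLetter k (suc c)) ⟩
    pow (u k) τ ++ tailWord (suc (suc c)) k ++ endLetter (suc c + k)
                                                              ≡⟨ sym (++-assoc (pow (u k) τ) _ _) ⟩
    tailWord (suc c) (suc k) ++ endLetter (suc (c + k))       ≡⟨ cong (λ i → tailWord (suc c) (suc k) ++ endLetter i) (sym (+-suc c k)) ⟩
    tailWord (suc c) (suc k) ++ endLetter (c + suc k)         ∎
    where
      open ≡-Reasoning
      τ = tailSeq m t (suc c) 0

  u≡tailWord++endLetter : 0 < m → ∀ k → u k ≡ tailWord 1 k ++ endLetter k
  u≡tailWord++endLetter 0<m k =
    trans (cong (λ b → φ^ m t k (if b then 0 ∷ [] else [])) (sym (<⇒<ᵇ≡true 0<m))) (φ^-endLetter k 0)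

  concat-pow≡tailWord : ∀ r {c} d (g : ℕ → List ℕ) →
                        (∀ i → g i ≡ pow (uw m t (+ d ℤ.- + suc i)) (t (c + i))) → c + r ≡ suc m →
                        concat (applyUpTo g r) ≡ tailWord c d
  concat-pow≡tailWord zero {c} d g _ c+0≡1+m =
    sym (tailWord-vanishes d (subst (m <_) (trans (sym c+0≡1+m) (+-identityʳ c)) (n<1+n m)))
  concat-pow≡tailWord (suc r) {c} zero g g≗ c+r+1≡1+m =
    cong₂ _++_ (trans (g≗ 0) (pow-[] (t (c + 0))))
      (concat-pow≡tailWord r zero (g ∘ suc)
        (λ i → trans (g≗ (suc i)) (trans (pow-[] (t (c + suc i))) (sym (pow-[] (t (suc c + i))))))
        (trans (sym (+-suc c r)) c+r+1≡1+m))
  concat-pow≡tailWord (suc r) {c} (suc d) g g≗ c+r+1≡1+m =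
    cong₂ _++_ (trans (g≗ 0) (cong (pow (u d)) (trans (cong t (+-identityʳ c)) (sym (tailSeq-head c≤m)))))
      (concat-pow≡tailWord r d (g ∘ suc) g∘suc≗ c+1+r≡1+m)
    where
      c+1+r≡1+m : suc c + r ≡ suc m
      c+1+r≡1+m = trans (sym (+-suc c r)) c+r+1≡1+m
      c≤m : c ≤ m
      c≤m = subst (c ≤_) (suc-injective c+1+r≡1+m) (m≤m+n c r)
      g∘suc≗ : ∀ i → g (suc i) ≡ pow (uw m t (+ d ℤ.- + suc i)) (t (suc c + i))
      g∘suc≗ i = trans (g≗ (suc i))
        (cong₂ (λ j k → pow (uw m t j) (t k)) (ℤₚ.[1+m]⊖[1+n]≡m⊖n d (suc i)) (+-suc c i))

module SimpleParrySequence {m : ℕ} {t : ℕ → ℕ} (sp : SimpleParry m t) where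

  open SimpleParry sp
  open Substitution m t public

  1≤m : 1 ≤ m
  1≤m = ≤-trans (s≤s z≤n) m≥2

  u≡tailWord₁++endLetter : ∀ k → u k ≡ tailWord 1 k ++ endLetter k
  u≡tailWord₁++endLetter = u≡tailWord++endLetter 1≤m

  u-∣ˡ-u-suc : ∀ k → u k ∣ˡ u (suc k)
  u-∣ˡ-u-suc k = ∣ˡ-respʳ-≈ (sym (u≡tailWord₁++endLetter (suc k)))
    (x∣ˡy⇒x∣ˡyz _ (pow-++-∣ˡ-< (tailWord 2 k) (subst (0 <_) (sym (tailSeq-head 1≤m)) t₁≥1) ∣ˡ-refl))

  u-mono : ∀ {a b} → a ≤ b → u a ∣ˡ u b
  u-mono = go ∘ ≤⇒≤‴
    where
      go : ∀ {a b} → a ≤‴ b → u a ∣ˡ u b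
      go ≤‴-refl      = ∣ˡ-refl
      go {a} (≤‴-step a<b) = ∣ˡ-trans (u-∣ˡ-u-suc a) (go a<b)

  u-nonempty : ∀ k → 1 ≤ length (u k)
  u-nonempty k = ∣ˡ⇒length-≤ (u-mono {0} {k} z≤n)

  length-φ-letter-≥1 : ∀ j → 1 ≤ length (φ-letter m t j)
  length-φ-letter-≥1 j with suc j <ᵇ m
  ... | true  = subst (1 ≤_) (sym (length-++ (replicate (t (suc j)) 0))) (m≤n+m 1 _)
  ... | false = subst (1 ≤_) (sym (length-replicate (t m))) tₘ≥1

  length-φ-letter₀-≥2 : 2 ≤ length (φ-letter m t 0)
  length-φ-letter₀-≥2 rewrite <⇒<ᵇ≡true m≥2 | length-++ (replicate (t 1) 0) {1 ∷ []} | length-replicate (t 1) {0} =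
    +-monoˡ-≤ 1 t₁≥1

  length-φ-≥ : ∀ w → length w ≤ length (φ m t w)
  length-φ-≥ []      = z≤n
  length-φ-≥ (j ∷ w) = subst (suc (length w) ≤_) (sym (length-++ (φ-letter m t j)))
    (+-mono-≤ (length-φ-letter-≥1 j) (length-φ-≥ w))

  -- u_k starts with 0, and φ(0) has length ≥ 2 while no letter is erased.
  length-u-< : ∀ k → length (u k) < length (u (suc k))
  length-u-< k with u-mono {0} {k} z≤n
  ... | q , 0∷q≡uₖ rewrite sym 0∷q≡uₖ = subst (2 + length q ≤_) (sym (length-++ (φ-letter m t 0)))
    (+-mono-≤ length-φ-letter₀-≥2 (length-φ-≥ q))

  length-u-≥ : ∀ k → k ≤ length (u k)
  length-u-≥ zero    = z≤n
  length-u-≥ (suc k) = ≤-trans (s≤s (length-u-≥ k)) (length-u-< k)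

  ∣ˡ-u⇒IsPrefixOf𝐮 : ∀ {w} K → w ∣ˡ u K → IsPrefixOf𝐮 m t w
  ∣ˡ-u⇒IsPrefixOf𝐮 {w} K w∣uK i = begin
    lookup w i             ≡⟨ lookup≡nth w i ⟩
    nth w j                ≡⟨ ∣ˡ⇒nth-≡ (∣ˡ-trans w∣uK (u-mono (m≤m+n K (suc j)))) (toℕ<n i) ⟩
    nth (u (K + suc j)) j  ≡⟨ sym (∣ˡ⇒nth-≡ (u-mono (m≤n+m (suc j) K)) (length-u-≥ (suc j))) ⟩
    𝐮 m t j                ∎
    where
      open ≡-Reasoning
      j = toℕ i

  mutual
    tailWord-≺lex : ∀ k {i j} → tailSeq m t i ≺lex tailSeq m t j → tailWord i k ∣ˡ tailWord j k
    tailWord-≺lex zero    _                      = ∣ˡ-refl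
    tailWord-≺lex (suc k) {i} (zero , _ , head<) = pow-++-∣ˡ-< _ head< (tailWord-∣ˡ-u k i)
    tailWord-≺lex (suc k) {i} {j} (suc p , agree , differ) =
      subst (λ a → (pow (u k) (tailSeq m t i 0) ++ tailWord (suc i) k) ∣ˡ (pow (u k) a ++ tailWord (suc j) k))
        (agree 0 z<s) (x∣ˡy⇒zx∣ˡzy _ (tailWord-≺lex k (p , agree′ , differ′)))
      where
        agree′ : ∀ q → q < p → tailSeq m t (suc i) q ≡ tailSeq m t (suc j) q
        agree′ q q<p = trans (tailSeq-suc i q) (trans (agree (suc q) (s≤s q<p)) (sym (tailSeq-suc j q)))
        differ′ : tailSeq m t (suc i) p < tailSeq m t (suc j) p
        differ′ = subst₂ _<_ (sym (tailSeq-suc i p)) (sym (tailSeq-suc j p)) differ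

    tailWord-∣ˡ-u : ∀ k c → tailWord (suc c) k ∣ˡ u k
    tailWord-∣ˡ-u k zero = ∣ˡ-respʳ-≈ (sym (u≡tailWord₁++endLetter k)) (x∣ˡxy _ _)
    tailWord-∣ˡ-u k (suc c) with suc (suc c) ≤? m
    ... | yes c+2≤m = ∣ˡ-trans (tailWord-≺lex k (lexC _ (s≤s (s≤s z≤n)) c+2≤m)) (tailWord-∣ˡ-u k zero)
    ... | no  c+2≰m = subst (_∣ˡ u k) (sym (tailWord-vanishes k (≰⇒> c+2≰m))) (ε∣ˡ u k)

  -- The first positive exponent among t_c, …, t_m (one exists, as t_m ≥ 1) contributes a power of some u_{K'}, K' ≥ K.
  u-∣ˡ-tailWord : ∀ e {c} K → c + e ≡ m → u K ∣ˡ tailWord c (suc e + K)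
  u-∣ˡ-tailWord zero {c} K c+0≡m =
    pow-++-∣ˡ-< _ (subst (0 <_) (sym (trans (tailSeq-head c≤m) (cong t c≡m))) tₘ≥1) ∣ˡ-refl
    where
      c≡m : c ≡ m
      c≡m = trans (sym (+-identityʳ c)) c+0≡m
      c≤m : c ≤ m
      c≤m = ≤-reflexive c≡m
  u-∣ˡ-tailWord (suc e) {c} K c+e+1≡m with tailSeq m t c 0
  ... | zero  = u-∣ˡ-tailWord e K (trans (sym (+-suc c e)) c+e+1≡m)
  ... | suc a = ∣ˡ-trans (u-mono (m≤n+m K (suc e))) (pow-++-∣ˡ-< {b = suc a} _ z<s ∣ˡ-refl)

  tₘ≤t₁ : t m ≤ t 1
  tₘ≤t₁ with lexC m m≥2 ≤-refl
  ... | zero  , _     , head< = <⇒≤ (subst₂ _<_ (tailSeq-head ≤-refl) (tailSeq-head 1≤m) head<)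
  ... | suc _ , agree , _     = ≤-reflexive (subst₂ _≡_ (tailSeq-head ≤-refl) (tailSeq-head 1≤m) (agree 0 z<s))

  δ : ℕ
  δ = t 1 ∸ t m

  uw-offset : ∀ d → uw m t (+ (m + d) ℤ.- + m) ≡ u d
  uw-offset d = cong (uw m t) (+[m+n]-m≡n m d)

  uw-offset-suc : ∀ d → uw m t (+ (m + d) ℤ.- + m ℤ.+ + 1) ≡ u (suc d)
  uw-offset-suc d = cong (uw m t) (trans (cong (ℤ._+ + 1) (+[m+n]-m≡n m d)) (cong +_ (+-comm d 1)))

  tailPart-offset : ∀ d → tailPart m t (m + d) ≡ tailWord 2 d
  tailPart-offset d = trans (cong concat (map-upTo _ (m ∸ 1)))
    (concat-pow≡tailWord (m ∸ 1) d _
      (λ i → cong (λ j → pow (uw m t (j ℤ.- + suc i)) (t (2 + i))) (+[m+n]-m≡n m d))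
      (cong suc (m+[n∸m]≡n 1≤m)))

  z-offset : ∀ d → z m t (m + d) ≡ u (m + d) ++ pow (u d) δ ++ tailWord 2 d
  z-offset d = cong₂ (λ v w → u (m + d) ++ pow v δ ++ w) (uw-offset d) (tailPart-offset d)

  s-offset : ∀ d → s m t (m + d) ≡ u (m + d) ++ pow (u d) (suc δ) ++ tailWord 2 d
  s-offset d = cong₂ (λ v w → u (m + d) ++ pow v (suc δ) ++ w) (uw-offset d) (tailPart-offset d)

  u-suc≡ : ∀ n → u (suc n) ≡ u n ++ (pow (u n) (t 1 ∸ 1) ++ tailWord 2 n) ++ endLetter (suc n)
  u-suc≡ n = begin
    u (suc n)                                                             ≡⟨ u≡tailWord₁++endLetter (suc n) ⟩
    (pow (u n) (tailSeq m t 1 0) ++ tailWord 2 n) ++ endLetter (suc n)    ≡⟨ cong (λ a → (pow (u n) a ++ tailWord 2 n) ++ endLetter (suc n)) t₁≡1+[t₁-1] ⟩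
    ((u n ++ pow (u n) (t 1 ∸ 1)) ++ tailWord 2 n) ++ endLetter (suc n)   ≡⟨ cong (_++ endLetter (suc n)) (++-assoc (u n) _ _) ⟩
    (u n ++ pow (u n) (t 1 ∸ 1) ++ tailWord 2 n) ++ endLetter (suc n)     ≡⟨ ++-assoc (u n) _ _ ⟩
    u n ++ (pow (u n) (t 1 ∸ 1) ++ tailWord 2 n) ++ endLetter (suc n)     ∎
    where
      open ≡-Reasoning
      t₁≡1+[t₁-1] : tailSeq m t 1 0 ≡ 1 + (t 1 ∸ 1)
      t₁≡1+[t₁-1] = trans (tailSeq-head 1≤m) (sym (m+[n∸m]≡n t₁≥1))

  pow-tailWord₂-∣ˡ-u-suc : ∀ d → (pow (u d) (suc δ) ++ tailWord 2 d) ∣ˡ u (suc d)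
  pow-tailWord₂-∣ˡ-u-suc d = ∣ˡ-respʳ-≈ (sym (u≡tailWord₁++endLetter (suc d)))
    (x∣ˡy⇒x∣ˡyz _ (pow-++-∣ˡ-≤ δ<t₁ (tailWord-∣ˡ-u d 1)))
    where
      δ<t₁ : δ < tailSeq m t 1 0
      δ<t₁ = subst (δ <_) (sym (tailSeq-head 1≤m)) (∸-monoʳ-< tₘ≥1 tₘ≤t₁)

  u-suc-∣ˡ-pow-tailWord₂ : ∀ d a → u (suc d) ∣ˡ (pow (u (m + d)) a ++ tailWord 2 (m + d))
  u-suc-∣ˡ-pow-tailWord₂ d a =
    ∣ˡ-trans (subst (λ k → u (suc d) ∣ˡ tailWord 2 k) m-1+d+1≡m+d
               (u-∣ˡ-tailWord (m ∸ 2) (suc d) (m+[n∸m]≡n m≥2)))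
             (pow-++-∣ˡ-≤ {b = a} z≤n (tailWord-∣ˡ-u (m + d) 1))
    where
      m-1+d+1≡m+d : suc (m ∸ 2) + suc d ≡ m + d
      m-1+d+1≡m+d = trans (+-suc (suc (m ∸ 2)) d) (cong (_+ d) (m+[n∸m]≡n m≥2))

  s-∣ˡ-u-suc : ∀ d → s m t (m + d) ∣ˡ u (suc (m + d))
  s-∣ˡ-u-suc d = subst₂ _∣ˡ_ (sym (s-offset d)) (sym (u-suc≡ (m + d)))
    (x∣ˡy⇒zx∣ˡzy (u (m + d))
      (x∣ˡy⇒x∣ˡyz _ (∣ˡ-trans (pow-tailWord₂-∣ˡ-u-suc d) (u-suc-∣ˡ-pow-tailWord₂ d (t 1 ∸ 1)))))

  z-∣ˡ-s : ∀ d → z m t (m + d) ∣ˡ s m t (m + d)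
  z-∣ˡ-s d = subst₂ _∣ˡ_ (sym (z-offset d)) (sym (s-offset d))
    (x∣ˡy⇒zx∣ˡzy (u (m + d)) (pow-++-∣ˡ-≤ (n≤1+n δ) (tailWord-∣ˡ-u d 1)))

  length-u-suc : ∀ d → length (u (suc d)) ≡ t 1 * length (u d) + length (tailWord 2 d) + length (endLetter (suc d))
  length-u-suc d = begin
    length (u (suc d))
      ≡⟨ cong length (u≡tailWord₁++endLetter (suc d)) ⟩
    length ((pow (u d) (tailSeq m t 1 0) ++ tailWord 2 d) ++ endLetter (suc d))
      ≡⟨ length-++ (pow (u d) (tailSeq m t 1 0) ++ tailWord 2 d) ⟩
    length (pow (u d) (tailSeq m t 1 0) ++ tailWord 2 d) + length (endLetter (suc d))
      ≡⟨ cong (_+ length (endLetter (suc d))) (length-++ (pow (u d) (tailSeq m t 1 0))) ⟩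
    length (pow (u d) (tailSeq m t 1 0)) + length (tailWord 2 d) + length (endLetter (suc d))
      ≡⟨ cong (λ n → n + length (tailWord 2 d) + length (endLetter (suc d)))
              (trans (length-pow (u d) (tailSeq m t 1 0)) (cong (_* length (u d)) (tailSeq-head 1≤m))) ⟩
    t 1 * length (u d) + length (tailWord 2 d) + length (endLetter (suc d)) ∎
    where open ≡-Reasoning

  length-z : ∀ d → Z m t (m + d) ≡ length (u (m + d)) + (δ * length (u d) + length (tailWord 2 d))
  length-z d = begin
    Z m t (m + d)                                             ≡⟨ cong length (z-offset d) ⟩
    length (u (m + d) ++ pow (u d) δ ++ tailWord 2 d)         ≡⟨ length-++ (u (m + d)) ⟩
    length (u (m + d)) + length (pow (u d) δ ++ tailWord 2 d) ≡⟨ cong (λ n → length (u (m + d)) + n) (length-++ (pow (u d) δ)) ⟩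
    length (u (m + d)) + (length (pow (u d) δ) + length (tailWord 2 d))
      ≡⟨ cong (λ n → length (u (m + d)) + (n + length (tailWord 2 d))) (length-pow (u d) δ) ⟩
    length (u (m + d)) + (δ * length (u d) + length (tailWord 2 d)) ∎
    where open ≡-Reasoning

  Z+tₘU+ℓ≡U+U : ∀ d → Z m t (m + d) + t m * length (u d) + length (endLetter (suc d)) ≡ length (u (m + d)) + length (u (suc d))
  Z+tₘU+ℓ≡U+U d = begin
    Z m t (m + d) + t m * B + ℓ                  ≡⟨ cong (λ n → n + t m * B + ℓ) (length-z d) ⟩
    A + (δ * B + W) + t m * B + ℓ                ≡⟨ regroup A δ (t m) B W ℓ ⟩
    A + ((δ + t m) * B + W + ℓ)                  ≡⟨ cong (λ a → A + (a * B + W + ℓ)) (m∸n+n≡m tₘ≤t₁) ⟩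
    A + (t 1 * B + W + ℓ)                        ≡⟨ cong (λ n → A + n) (sym (length-u-suc d)) ⟩
    A + length (u (suc d))                       ∎
    where
      open ≡-Reasoning
      A = length (u (m + d))
      B = length (u d)
      W = length (tailWord 2 d)
      ℓ = length (endLetter (suc d))
      regroup : ∀ A δ τ B W ℓ → A + (δ * B + W) + τ * B + ℓ ≡ A + ((δ + τ) * B + W + ℓ)
      regroup = solve-∀

  U-offset : ∀ d → U m t (+ (m + d) ℤ.- + m) ≡ length (u d)
  U-offset d = cong length (uw-offset d)

  U-offset-suc : ∀ d → U m t (+ (m + d) ℤ.- + m ℤ.+ + 1) ≡ length (u (suc d))
  U-offset-suc d = cong length (uw-offset-suc d)

  S≡Z+U : ∀ n → S m t n ≡ Z m t n + U m t (+ n ℤ.- + m)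
  S≡Z+U n = length-++-pow-suc (uw m t (+ n)) (uw m t (+ n ℤ.- + m)) δ (tailPart m t n)

  U≤Z : ∀ n → U m t (+ n) ≤ Z m t n
  U≤Z n = ∣ˡ⇒length-≤ (x∣ˡxy (uw m t (+ n)) _)

  Z<S : ∀ d → Z m t (m + d) < S m t (m + d)
  Z<S d = subst (Z m t (m + d) <_) (sym (S≡Z+U (m + d)))
    (m<m+n (Z m t (m + d)) (subst (1 ≤_) (sym (U-offset d)) (u-nonempty d)))

  Z-formula : ∀ d → 2 * m ≤ suc (m + d) →
              + Z m t (m + d) ≡ + U m t (+ (m + d)) ℤ.+ + U m t (+ (m + d) ℤ.- + m ℤ.+ + 1)
                                  ℤ.- + t m ℤ.* + U m t (+ (m + d) ℤ.- + m)
  Z-formula d 2m≤1+m+d =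
    subst₂ (λ U₁ B → + Z m t (m + d) ≡ + length (u (m + d)) ℤ.+ + U₁ ℤ.- + t m ℤ.* + B)
      (sym (U-offset-suc d)) (sym (U-offset d))
      (i+j≡k⇒i≡k-j (+ t m ℤ.* + length (u d))
        (trans (cong (λ i → + Z m t (m + d) ℤ.+ i) (sym (ℤₚ.pos-* (t m) (length (u d))))) (cong +_ Z+tₘU≡U+U)))
    where
      m≤1+d : m ≤ suc d
      m≤1+d = +-cancelˡ-≤ m m (suc d)
        (subst₂ _≤_ (cong (λ k → m + k) (+-identityʳ m)) (sym (+-suc m d)) 2m≤1+m+d)
      Z+tₘU≡U+U : Z m t (m + d) + t m * length (u d) ≡ length (u (m + d)) + length (u (suc d))
      Z+tₘU≡U+U = trans (sym (+-identityʳ _))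
        (trans (cong (λ ℓ → Z m t (m + d) + t m * length (u d) + ℓ) (sym (cong length (endLetter-vanishes m≤1+d))))
          (Z+tₘU+ℓ≡U+U d))

  Z≤P : ∀ d → 1 < t m → + Z m t (m + d) ℤ.≤ P m t (m + d)
  Z≤P d 2≤tₘ =
    subst₂ (λ U₁ B → + Z m t (m + d) ℤ.≤ + length (u (m + d)) ℤ.+ + U₁ ℤ.- + B ℤ.- + 1)
      (sym (U-offset-suc d)) (sym (U-offset d))
      (i+j≤k⇒i≤k-j (+ 1) (i+j≤k⇒i≤k-j (+ length (u d)) (ℤ.+≤+ Z+1+U≤U+U)))
    where
      Z+1+U≤U+U : Z m t (m + d) + 1 + length (u d) ≤ length (u (m + d)) + length (u (suc d))
      Z+1+U≤U+U = begin
        Z m t (m + d) + 1 + length (u d)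
          ≡⟨ +-assoc (Z m t (m + d)) 1 _ ⟩
        Z m t (m + d) + suc (length (u d))
          ≤⟨ +-monoʳ-≤ (Z m t (m + d)) (1+n≤m*n 2≤tₘ (u-nonempty d)) ⟩
        Z m t (m + d) + t m * length (u d)
          ≤⟨ m≤m+n _ _ ⟩
        Z m t (m + d) + t m * length (u d) + length (endLetter (suc d))
          ≡⟨ Z+tₘU+ℓ≡U+U d ⟩
        length (u (m + d)) + length (u (suc d)) ∎
        where open ≤-Reasoning

lemma4p13 : (m : ℕ) (t : ℕ → ℕ) → SimpleParry m t →
            (n : ℕ) → m ≤ n →
            (IsPrefixOf𝐮 m t (z m t n) × IsPrefixOf𝐮 m t (s m t n))
            × (2 * m ≤ suc n →
                 + Z m t n ≡ + U m t (+ n) ℤ.+ + U m t (+ n ℤ.- + m ℤ.+ + 1)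
                              ℤ.- + t m ℤ.* + U m t (+ n ℤ.- + m))
            × (S m t n ≡ Z m t n + U m t (+ n ℤ.- + m))
            × (U m t (+ n) ≤ Z m t n × Z m t n < S m t n × S m t n ≤ U m t (+ suc n))
            × (1 < t m → + Z m t n ℤ.≤ P m t n)
lemma4p13 m t sp n m≤n with m≤n⇒∃[o]m+o≡n m≤n
... | d , refl =
    ( ∣ˡ-u⇒IsPrefixOf𝐮 (suc (m + d)) (∣ˡ-trans (z-∣ˡ-s d) (s-∣ˡ-u-suc d))
    , ∣ˡ-u⇒IsPrefixOf𝐮 (suc (m + d)) (s-∣ˡ-u-suc d) )
  , Z-formula d
  , S≡Z+U (m + d)
  , (U≤Z (m + d) , Z<S d , ∣ˡ⇒length-≤ (s-∣ˡ-u-suc d))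
  , Z≤P d
  where open SimpleParrySequence sp
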